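{- For an integer $n\ge 2$ let $\mathtt{A}^{(n)}=[a_{ij}]$ be the $n\times n$ matrix with $a_{ij}=1$ if $j=i+1$ or $i+j=n+1$, and $a_{ij}=0$ otherwise ($i,j\in\{1,\dots,n\}$), and let $P_n(\lambda)=|\mathtt{A}^{(n)}-\lambda \mathtt{I}|$ be its characteristic polynomial. Then for every $n\ge 6$, $$P_n(\lambda)=\lambda^2\big(P_{n-2}(\lambda)-P_{n-4}(\lambda)\big).$$
   Context: $\mathtt{I}$ denotes the identity matrix of the appropriate size and $|\cdot|$ the determinant. The matrix $\mathtt{A}^{(n)}$ is the adjacency matrix of the relation "the composition $\nabla_j\circ\nabla_i$ is meaningful" for the chain of maps $\nabla_1,\dots,\nabla_n$ between sets $A_0,\dots,A_{[n/2]}$ going up $A_0\to A_1\to\cdots$ and back down $\cdots\to A_1\to A_0$. -}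

module Defs where

open import Level using (_⊔_)
open import Algebra.Bundles using (CommutativeRing)
open import Data.Nat using (ℕ; zero; suc; _≡ᵇ_) renaming (_+_ to _+ℕ_)
open import Data.Bool using (Bool; true; false; _∨_; if_then_else_)
open import Data.Fin using (Fin; zero; suc; toℕ; punchIn)

-- Square matrices over the carrier of a commutative ring, indexed by Fin n
-- (0-based indices; entry (i,j) here is entry (i+1,j+1) of the paper).
module _ {c ℓ} (R : CommutativeRing c ℓ) where
  open CommutativeRing R using (Carrier; 0#; 1#; -_; _-_) renaming (_+_ to _+_; _*_ to _*_)

  Matrix : ℕ → Set c
  Matrix n = Fin n → Fin n → Carrier

  ΣFin : (n : ℕ) → (Fin n → Carrier) → Carrier
  ΣFin zero    f = 0#
  ΣFin (suc n) f = f zero + ΣFin n (λ k → f (suc k))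

  sgn : ℕ → Carrier
  sgn zero    = 1#
  sgn (suc k) = - sgn k

  minor : {n : ℕ} → Matrix (suc n) → Fin (suc n) → Matrix n
  minor M j r s = M (suc r) (punchIn j s)

  det : (n : ℕ) → Matrix n → Carrier
  det zero    M = 1#
  det (suc n) M = ΣFin (suc n) (λ j → sgn (toℕ j) * (M zero j * det n (minor M j)))

  idMat : (n : ℕ) → Matrix n
  idMat n i j = if toℕ i ≡ᵇ toℕ j then 1# else 0#

  adjBool : (n : ℕ) → Fin n → Fin n → Bool
  adjBool n i j = (toℕ j ≡ᵇ suc (toℕ i)) ∨ (suc (toℕ i) +ℕ suc (toℕ j) ≡ᵇ suc n)

  A : (n : ℕ) → Matrix n
  A n i j = if adjBool n i j then 1# else 0#

  P : (n : ℕ) → Carrier → Carrier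
  P n x = det n (λ i j → A n i j - x * idMat n i j)

-- Write χₙ = A⁽ⁿ⁾ − λI; deleting the first and last rows and columns of χₙ₊₂ leaves χₙ.
-- The last row of χₙ is e₁ − λ eₙ. By linearity in that row, det χₙ splits into −λ times
-- the leading (n−1)-block, whose first column is −λ e₁ and whose interior is χₙ₋₂, plus a
-- signed Qₙ₋₁, the minor of χₙ without its last row and first column:
--   Pₙ = λ² Pₙ₋₂ + (−1)ⁿ⁻¹ Qₙ₋₁.
-- The matrix of Qₘ₊₂ has first row e₁ + e_last; expanding along it gives
--   Qₘ₊₂ = Qₘ + (−1)ᵐ⁺¹ Pₘ₊₁,
-- and eliminating Q between the two recurrences yields Pₙ = λ² (Pₙ₋₂ − Pₙ₋₄).
module Submission where

open import Algebra.Bundles using (CommutativeRing)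
open import Data.Bool using (Bool; _∨_; if_then_else_)
open import Data.Bool.Properties using (∨-zeroʳ)
open import Data.Fin using (Fin; zero; suc; toℕ; fromℕ; inject₁; punchIn)
open import Data.Fin.Properties using (toℕ-inject₁; toℕ-fromℕ; toℕ<n; inject₁ℕ<; fromℕ≢inject₁)
open import Data.Nat as ℕ using (ℕ; zero; suc; _≡ᵇ_; _≤_; _<_; _∸_; s≤s; z≤n; s<s)
open import Data.Nat.Properties as ℕₚ
  using (_≟_; +-suc; suc-injective; <⇒≢; >⇒≢; m<n⇒m<1+n; m+1+n≢m; m+1+n≢n; m≢1+n+m)
open import Data.Vec.Functional using (updateAt)
open import Data.Vec.Functional.Properties using (updateAt-updates; updateAt-minimal)
open import Function using (_∘_)
open import Relation.Binary.PropositionalEquality as ≡ using (_≡_; _≢_; ≢-sym)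
open import Relation.Nullary.Decidable using (dec-true; dec-false)

open import Defs

punchIn-fromℕ : ∀ {n} (i : Fin n) → punchIn (fromℕ n) i ≡ inject₁ i
punchIn-fromℕ zero    = ≡.refl
punchIn-fromℕ (suc i) = ≡.cong suc (punchIn-fromℕ i)

punchIn-inject₁ : ∀ {n} (j : Fin (suc n)) (i : Fin n) →
                  punchIn (inject₁ j) (inject₁ i) ≡ inject₁ (punchIn j i)
punchIn-inject₁ zero    i       = ≡.refl
punchIn-inject₁ (suc j) zero    = ≡.refl
punchIn-inject₁ (suc j) (suc i) = ≡.cong suc (punchIn-inject₁ j i)

punchIn-inject₁-fromℕ : ∀ {n} (j : Fin (suc n)) → punchIn (inject₁ j) (fromℕ n) ≡ fromℕ (suc n)
punchIn-inject₁-fromℕ {n}     zero    = ≡.refl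
punchIn-inject₁-fromℕ {suc n} (suc j) = ≡.cong suc (punchIn-inject₁-fromℕ j)

module RingLemmas {c ℓ} (R : CommutativeRing c ℓ) where
  open CommutativeRing R
  open import Algebra.Properties.Ring ring using (-‿distribˡ-*; -‿distribʳ-*; -‿involutive; -‿anti-homo-+; -0#≈0#)
  open import Algebra.Properties.CommutativeSemigroup *-commutativeSemigroup using (x∙yz≈y∙xz)
  open import Relation.Binary.Reasoning.Setoid setoid

  -x*-y≈x*y : ∀ a b → - a * - b ≈ a * b
  -x*-y≈x*y a b = begin
    - a * - b     ≈⟨ -‿distribˡ-* a (- b) ⟨
    - (a * - b)   ≈⟨ -‿cong (-‿distribʳ-* a b) ⟨
    - - (a * b)   ≈⟨ -‿involutive (a * b) ⟩
    a * b         ∎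

  x-0≈x : ∀ a → a - 0# ≈ a
  x-0≈x a = trans (+-congˡ -0#≈0#) (+-identityʳ a)

  x*[y*[z*w]]≈z*[x*[y*w]] : ∀ a b c d → a * (b * (c * d)) ≈ c * (a * (b * d))
  x*[y*[z*w]]≈z*[x*[y*w]] a b c d = trans (*-congˡ (x∙yz≈y∙xz b c d)) (x∙yz≈y∙xz a c (b * d))

  y-[x+y]≈-x : ∀ a b → b - (a + b) ≈ - a
  y-[x+y]≈-x a b = begin
    b - (a + b)     ≈⟨ +-congˡ (-‿anti-homo-+ a b) ⟩
    b + (- b + - a) ≈⟨ +-assoc b (- b) (- a) ⟨
    b - b + - a     ≈⟨ +-congʳ (-‿inverseʳ b) ⟩
    0# + - a        ≈⟨ +-identityˡ (- a) ⟩
    - a             ∎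

module Determinant {c ℓ} (R : CommutativeRing c ℓ) where
  open CommutativeRing R hiding (zero)
  open RingLemmas R
  open import Algebra.Properties.Ring ring using (-‿distribˡ-*; //-rightDividesˡ; x≈y⇒x∙y⁻¹≈ε)
  open import Algebra.Properties.Semiring.Sum semiring
    using (sum; sum-cong-≋; sum-replicate-zero; sum-init-last; ∑-distrib-+; *-distribˡ-sum)
  open import Relation.Binary.Reasoning.Setoid setoid

  sgn-square : ∀ k → sgn R k * sgn R k ≈ 1#
  sgn-square zero    = *-identityˡ 1#
  sgn-square (suc k) = trans (-x*-y≈x*y (sgn R k) (sgn R k)) (sgn-square k)

  sgn-suc-cancel : ∀ k a → sgn R (suc k) * (sgn R k * a) ≈ - a
  sgn-suc-cancel k a = begin
    - sgn R k * (sgn R k * a)   ≈⟨ -‿distribˡ-* _ _ ⟨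
    - (sgn R k * (sgn R k * a)) ≈⟨ -‿cong (*-assoc _ _ _) ⟨
    - (sgn R k * sgn R k * a)   ≈⟨ -‿cong (trans (*-congʳ (sgn-square k)) (*-identityˡ a)) ⟩
    - a                         ∎

  laplaceTerm : ∀ {n} → Matrix R (suc n) → Fin (suc n) → Carrier
  laplaceTerm {n} M j = sgn R (toℕ j) * (M zero j * det R n (minor R M j))

  ΣFin≡sum : ∀ n (f : Fin n → Carrier) → ΣFin R n f ≡ sum f
  ΣFin≡sum zero    f = ≡.refl
  ΣFin≡sum (suc n) f = ≡.cong (f zero +_) (ΣFin≡sum n (λ i → f (suc i)))

  det-laplace : ∀ {n} (M : Matrix R (suc n)) → det R (suc n) M ≡ sum (laplaceTerm M)
  det-laplace {n} M = ΣFin≡sum (suc n) (laplaceTerm M)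

  sum-zero : ∀ {n} (f : Fin n → Carrier) → (∀ i → f i ≈ 0#) → sum f ≈ 0#
  sum-zero {n} f f≈0 = trans (sum-cong-≋ f≈0) (sum-replicate-zero n)

  laplaceTerm-entry≈0 : ∀ {n} (M : Matrix R (suc n)) j → M zero j ≈ 0# → laplaceTerm M j ≈ 0#
  laplaceTerm-entry≈0 M j M0j≈0 = trans (*-congˡ (trans (*-congʳ M0j≈0) (zeroˡ _))) (zeroʳ _)

  laplaceTerm-minor≈0 : ∀ {n} (M : Matrix R (suc n)) j → det R n (minor R M j) ≈ 0# → laplaceTerm M j ≈ 0#
  laplaceTerm-minor≈0 M j det≈0 = trans (*-congˡ (trans (*-congˡ det≈0) (zeroʳ _))) (zeroʳ _)

  det-cong : ∀ n {M N : Matrix R n} → (∀ i j → M i j ≈ N i j) → det R n M ≈ det R n N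
  det-cong zero    M≈N = refl
  det-cong (suc n) {M} {N} M≈N = begin
    det R (suc n) M     ≡⟨ det-laplace M ⟩
    sum (laplaceTerm M) ≈⟨ sum-cong-≋ term≈ ⟩
    sum (laplaceTerm N) ≡⟨ det-laplace N ⟨
    det R (suc n) N     ∎
    where
    term≈ : ∀ j → laplaceTerm M j ≈ laplaceTerm N j
    term≈ j = *-congˡ (*-cong (M≈N zero j) (det-cong n λ r s → M≈N (suc r) (punchIn j s)))

  det₁ : (M : Matrix R 1) → det R 1 M ≈ M zero zero
  det₁ M = trans (+-identityʳ _) (trans (*-identityˡ _) (*-identityʳ _))

  det-zeroLastRow : ∀ n (M : Matrix R (suc n)) → (∀ j → M (fromℕ n) j ≈ 0#) → det R (suc n) M ≈ 0#
  det-zeroLastRow zero    M row≈0 = trans (det₁ M) (row≈0 zero)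
  det-zeroLastRow (suc n) M row≈0 = trans (reflexive (det-laplace M)) (sum-zero _ λ j →
    laplaceTerm-minor≈0 M j (det-zeroLastRow n (minor R M j) (λ s → row≈0 (punchIn j s))))

  det-zeroFirstColumn : ∀ n (M : Matrix R (suc n)) → (∀ i → M i zero ≈ 0#) → det R (suc n) M ≈ 0#
  det-zeroFirstColumn zero    M col≈0 = trans (det₁ M) (col≈0 zero)
  det-zeroFirstColumn (suc n) M col≈0 = trans (reflexive (det-laplace M)) (sum-zero _ term≈0)
    where
    term≈0 : ∀ j → laplaceTerm M j ≈ 0#
    term≈0 zero    = laplaceTerm-entry≈0 M zero (col≈0 zero)
    term≈0 (suc j) = laplaceTerm-minor≈0 M (suc j)
      (det-zeroFirstColumn n (minor R M (suc j)) (λ r → col≈0 (suc r)))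

  det-firstColumn-corner : ∀ n (M : Matrix R (suc (suc n))) → (∀ i → M (suc i) zero ≈ 0#) →
                           det R (suc (suc n)) M ≈ M zero zero * det R (suc n) (minor R M zero)
  det-firstColumn-corner n M col≈0 = begin
    det R (suc (suc n)) M                                ≡⟨ det-laplace M ⟩
    laplaceTerm M zero + sum (λ j → laplaceTerm M (suc j)) ≈⟨ +-cong (*-identityˡ _) (sum-zero _ term≈0) ⟩
    M zero zero * det R (suc n) (minor R M zero) + 0#    ≈⟨ +-identityʳ _ ⟩
    M zero zero * det R (suc n) (minor R M zero)         ∎
    where
    term≈0 : ∀ j → laplaceTerm M (suc j) ≈ 0#
    term≈0 j = laplaceTerm-minor≈0 M (suc j)
      (det-zeroFirstColumn n (minor R M (suc j)) col≈0)

  det-firstRow-firstLast : ∀ n (M : Matrix R (suc (suc n))) → (∀ j → M zero (suc (inject₁ j)) ≈ 0#) →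
    det R (suc (suc n)) M ≈ M zero zero * det R (suc n) (minor R M zero)
      + sgn R (suc n) * (M zero (fromℕ (suc n)) * det R (suc n) (minor R M (fromℕ (suc n))))
  det-firstRow-firstLast n M row≈0 = begin
    det R (suc (suc n)) M
      ≡⟨ det-laplace M ⟩
    laplaceTerm M zero + sum (λ j → laplaceTerm M (suc j))
      ≈⟨ +-congˡ (sum-init-last (λ j → laplaceTerm M (suc j))) ⟩
    laplaceTerm M zero + (sum (λ j → laplaceTerm M (suc (inject₁ j))) + laplaceTerm M (fromℕ (suc n)))
      ≈⟨ +-cong (*-identityˡ _) (+-cong (sum-zero _ middle≈0) (*-congʳ (reflexive lastSign))) ⟩
    M zero zero * det R (suc n) (minor R M zero) + (0# + lastTerm)
      ≈⟨ +-congˡ (+-identityˡ _) ⟩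
    M zero zero * det R (suc n) (minor R M zero) + lastTerm ∎
    where
    lastTerm : Carrier
    lastTerm = sgn R (suc n) * (M zero (fromℕ (suc n)) * det R (suc n) (minor R M (fromℕ (suc n))))
    middle≈0 : ∀ j → laplaceTerm M (suc (inject₁ j)) ≈ 0#
    middle≈0 j = laplaceTerm-entry≈0 M _ (row≈0 j)
    lastSign : sgn R (toℕ (fromℕ (suc n))) ≡ sgn R (suc n)
    lastSign = ≡.cong (sgn R) (toℕ-fromℕ (suc n))

  leading : ∀ {n} → Matrix R (suc n) → Matrix R n
  leading M i j = M (inject₁ i) (inject₁ j)

  minor-inject₁-leading : ∀ n (M : Matrix R (suc (suc n))) j →
    ∀ r s → leading (minor R M (inject₁ j)) r s ≡ minor R (leading M) j r s
  minor-inject₁-leading n M j r s = ≡.cong (M (inject₁ (suc r))) (punchIn-inject₁ j s)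

  det-scaledLeading-step : ∀ n (M : Matrix R (suc (suc n))) k →
    (∀ j → det R (suc n) (minor R M (inject₁ j)) ≈ k * det R n (leading (minor R M (inject₁ j)))) →
    laplaceTerm M (fromℕ (suc n)) ≈ 0# →
    det R (suc (suc n)) M ≈ k * det R (suc n) (leading M)
  det-scaledLeading-step n M k minor≈ last≈0 = begin
    det R (suc (suc n)) M
      ≡⟨ det-laplace M ⟩
    sum (laplaceTerm M)
      ≈⟨ sum-init-last (laplaceTerm M) ⟩
    sum (λ j → laplaceTerm M (inject₁ j)) + laplaceTerm M (fromℕ (suc n))
      ≈⟨ +-cong (sum-cong-≋ term≈) last≈0 ⟩
    sum (λ j → k * laplaceTerm (leading M) j) + 0#
      ≈⟨ +-identityʳ _ ⟩
    sum (λ j → k * laplaceTerm (leading M) j)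
      ≈⟨ *-distribˡ-sum k (laplaceTerm (leading M)) ⟨
    k * sum (laplaceTerm (leading M))
      ≡⟨ ≡.cong (k *_) (det-laplace (leading M)) ⟨
    k * det R (suc n) (leading M) ∎
    where
    term≈ : ∀ j → laplaceTerm M (inject₁ j) ≈ k * laplaceTerm (leading M) j
    term≈ j = trans (*-cong (reflexive (≡.cong (sgn R) (toℕ-inject₁ j)))
                            (*-congˡ (trans (minor≈ j) (*-congˡ (det-cong n λ r s →
                              reflexive (minor-inject₁-leading n M j r s))))))
                    (x*[y*[z*w]]≈z*[x*[y*w]] _ _ k _)

  det-lastRow-corner : ∀ n (M : Matrix R (suc n)) k →
    (∀ j → M (fromℕ n) (inject₁ j) ≈ 0#) → M (fromℕ n) (fromℕ n) ≈ k →
    det R (suc n) M ≈ k * det R n (leading M)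
  det-lastRow-corner zero    M k row≈0 corner≈k = trans (det₁ M) (trans corner≈k (sym (*-identityʳ k)))
  det-lastRow-corner (suc n) M k row≈0 corner≈k = det-scaledLeading-step n M k minor≈ last≈0
    where
    minor≈ : ∀ j → det R (suc n) (minor R M (inject₁ j)) ≈ k * det R n (leading (minor R M (inject₁ j)))
    minor≈ j = det-lastRow-corner n (minor R M (inject₁ j)) k
      (λ s → trans (reflexive (≡.cong (M (fromℕ (suc n))) (punchIn-inject₁ j s))) (row≈0 (punchIn j s)))
      (trans (reflexive (≡.cong (M (fromℕ (suc n))) (punchIn-inject₁-fromℕ j))) corner≈k)
    last≈0 : laplaceTerm M (fromℕ (suc n)) ≈ 0#
    last≈0 = laplaceTerm-minor≈0 M _ (det-zeroLastRow n (minor R M (fromℕ (suc n))) λ s →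
      trans (reflexive (≡.cong (M (fromℕ (suc n))) (punchIn-fromℕ s))) (row≈0 s))

  det-lastColumn-corner : ∀ n (M : Matrix R (suc n)) k →
    (∀ i → M (inject₁ i) (fromℕ n) ≈ 0#) → M (fromℕ n) (fromℕ n) ≈ k →
    det R (suc n) M ≈ k * det R n (leading M)
  det-lastColumn-corner zero    M k col≈0 corner≈k = trans (det₁ M) (trans corner≈k (sym (*-identityʳ k)))
  det-lastColumn-corner (suc n) M k col≈0 corner≈k = det-scaledLeading-step n M k minor≈ last≈0
    where
    minor≈ : ∀ j → det R (suc n) (minor R M (inject₁ j)) ≈ k * det R n (leading (minor R M (inject₁ j)))
    minor≈ j = det-lastColumn-corner n (minor R M (inject₁ j)) k
      (λ i → trans (reflexive (≡.cong (M (inject₁ (suc i))) (punchIn-inject₁-fromℕ j))) (col≈0 (suc i)))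
      (trans (reflexive (≡.cong (M (fromℕ (suc n))) (punchIn-inject₁-fromℕ j))) corner≈k)
    last≈0 : laplaceTerm M (fromℕ (suc n)) ≈ 0#
    last≈0 = laplaceTerm-entry≈0 M _ (col≈0 zero)

  minorLastFirst : ∀ {n} → Matrix R (suc (suc n)) → Matrix R (suc n)
  minorLastFirst M i j = M (inject₁ i) (suc j)

  det-lastRow-first : ∀ n (M : Matrix R (suc (suc n))) k →
    M (fromℕ (suc n)) zero ≈ k → (∀ j → M (fromℕ (suc n)) (suc j) ≈ 0#) →
    det R (suc (suc n)) M ≈ sgn R (suc n) * (k * det R (suc n) (minorLastFirst M))
  det-lastRow-first zero M k first≈k rest≈0 = begin
    laplaceTerm M zero + (laplaceTerm M (suc zero) + 0#)
      ≈⟨ +-cong (laplaceTerm-minor≈0 M zero (trans (det₁ (minor R M zero)) (rest≈0 zero))) (+-identityʳ _) ⟩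
    0# + sgn R 1 * (M zero (suc zero) * det R 1 (minor R M (suc zero)))
      ≈⟨ +-identityˡ _ ⟩
    sgn R 1 * (M zero (suc zero) * det R 1 (minor R M (suc zero)))
      ≈⟨ *-congˡ (trans (*-cong (sym (det₁ (minorLastFirst M))) (trans (det₁ (minor R M (suc zero))) first≈k))
                        (*-comm _ _)) ⟩
    sgn R 1 * (k * det R 1 (minorLastFirst M)) ∎
  det-lastRow-first (suc n) M k first≈k rest≈0 = begin
    det R (suc (suc (suc n))) M
      ≡⟨ det-laplace M ⟩
    laplaceTerm M zero + sum (λ j → laplaceTerm M (suc j))
      ≈⟨ +-cong (laplaceTerm-minor≈0 M zero (det-zeroLastRow (suc n) (minor R M zero) rest≈0))
                (sum-cong-≋ term≈) ⟩
    0# + sum (λ j → - σ * (k * laplaceTerm N j))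
      ≈⟨ +-identityˡ _ ⟩
    sum (λ j → - σ * (k * laplaceTerm N j))
      ≈⟨ *-distribˡ-sum (- σ) (λ j → k * laplaceTerm N j) ⟨
    - σ * sum (λ j → k * laplaceTerm N j)
      ≈⟨ *-congˡ (*-distribˡ-sum k (laplaceTerm N)) ⟨
    - σ * (k * sum (laplaceTerm N))
      ≡⟨ ≡.cong (λ d → - σ * (k * d)) (det-laplace N) ⟨
    - σ * (k * det R (suc (suc n)) N) ∎
    where
    σ : Carrier
    σ = sgn R (suc n)
    N : Matrix R (suc (suc n))
    N = minorLastFirst M
    term≈ : ∀ j → laplaceTerm M (suc j) ≈ - σ * (k * laplaceTerm N j)
    term≈ j = begin
      - sgn R (toℕ j) * (M zero (suc j) * det R (suc (suc n)) (minor R M (suc j)))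
        ≈⟨ *-congˡ (*-congˡ (det-lastRow-first n (minor R M (suc j)) k first≈k (λ s → rest≈0 (punchIn j s)))) ⟩
      - sgn R (toℕ j) * (M zero (suc j) * (σ * (k * det R (suc n) (minor R N j))))
        ≈⟨ -‿distribˡ-* _ _ ⟨
      - (sgn R (toℕ j) * (M zero (suc j) * (σ * (k * det R (suc n) (minor R N j)))))
        ≈⟨ -‿cong (trans (x*[y*[z*w]]≈z*[x*[y*w]] _ _ σ _) (*-congˡ (x*[y*[z*w]]≈z*[x*[y*w]] _ _ k _))) ⟩
      - (σ * (k * laplaceTerm N j))
        ≈⟨ -‿distribˡ-* _ _ ⟩
      - σ * (k * laplaceTerm N j) ∎

  det-linear-lastRow : ∀ n (M M₁ M₂ : Matrix R (suc n)) →
    (∀ i j → M (inject₁ i) j ≈ M₁ (inject₁ i) j) → (∀ i j → M (inject₁ i) j ≈ M₂ (inject₁ i) j) →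
    (∀ j → M (fromℕ n) j ≈ M₁ (fromℕ n) j + M₂ (fromℕ n) j) →
    det R (suc n) M ≈ det R (suc n) M₁ + det R (suc n) M₂
  det-linear-lastRow zero M M₁ M₂ _ _ last≈ =
    trans (det₁ M) (trans (last≈ zero) (sym (+-cong (det₁ M₁) (det₁ M₂))))
  det-linear-lastRow (suc n) M M₁ M₂ above₁ above₂ last≈ = begin
    det R (suc (suc n)) M                                   ≡⟨ det-laplace M ⟩
    sum (laplaceTerm M)                                     ≈⟨ sum-cong-≋ term≈ ⟩
    sum (λ j → laplaceTerm M₁ j + laplaceTerm M₂ j)         ≈⟨ ∑-distrib-+ (laplaceTerm M₁) (laplaceTerm M₂) ⟩
    sum (laplaceTerm M₁) + sum (laplaceTerm M₂)             ≡⟨ ≡.cong₂ _+_ (det-laplace M₁) (det-laplace M₂) ⟨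
    det R (suc (suc n)) M₁ + det R (suc (suc n)) M₂         ∎
    where
    term≈ : ∀ j → laplaceTerm M j ≈ laplaceTerm M₁ j + laplaceTerm M₂ j
    term≈ j = begin
      σ * (M zero j * det R (suc n) (minor R M j))
        ≈⟨ *-congˡ (*-congˡ (det-linear-lastRow n (minor R M j) (minor R M₁ j) (minor R M₂ j)
             (λ i s → above₁ (suc i) (punchIn j s)) (λ i s → above₂ (suc i) (punchIn j s))
             (λ s → last≈ (punchIn j s)))) ⟩
      σ * (M zero j * (d₁ + d₂))                ≈⟨ *-congˡ (distribˡ _ _ _) ⟩
      σ * (M zero j * d₁ + M zero j * d₂)       ≈⟨ distribˡ _ _ _ ⟩
      σ * (M zero j * d₁) + σ * (M zero j * d₂) ≈⟨ +-cong (*-congˡ (*-congʳ (above₁ zero j)))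
                                                            (*-congˡ (*-congʳ (above₂ zero j))) ⟩
      laplaceTerm M₁ j + laplaceTerm M₂ j       ∎
      where
      σ d₁ d₂ : Carrier
      σ  = sgn R (toℕ j)
      d₁ = det R (suc n) (minor R M₁ j)
      d₂ = det R (suc n) (minor R M₂ j)

  firstOnly : ∀ {n} → Carrier → Fin (suc n) → Carrier
  firstOnly a zero    = a
  firstOnly a (suc _) = 0#

  det-lastRow-firstLast : ∀ n (M : Matrix R (suc (suc n))) a b →
    M (fromℕ (suc n)) zero ≈ a → M (fromℕ (suc n)) (fromℕ (suc n)) ≈ b →
    (∀ j → M (fromℕ (suc n)) (suc (inject₁ j)) ≈ 0#) →
    det R (suc (suc n)) M ≈ b * det R (suc n) (leading M) + sgn R (suc n) * (a * det R (suc n) (minorLastFirst M))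
  det-lastRow-firstLast n M a b first≈a last≈b middle≈0 = begin
    det R (suc (suc n)) M
      ≈⟨ det-linear-lastRow (suc n) M M₁ M₂ (above M₁-row) (above M₂-row) split ⟩
    det R (suc (suc n)) M₁ + det R (suc (suc n)) M₂
      ≈⟨ +-cong (det-lastRow-corner (suc n) M₁ b M₁-lastRow≈0 M₁-corner≈b)
                (det-lastRow-first n M₂ a (lastRow M₂-row zero) (λ j → lastRow M₂-row (suc j))) ⟩
    b * det R (suc n) (leading M₁) + sgn R (suc n) * (a * det R (suc n) (minorLastFirst M₂))
      ≈⟨ +-cong (*-congˡ (det-cong (suc n) λ i j → sym (above M₁-row i (inject₁ j))))
                (*-congˡ (*-congˡ (det-cong (suc n) λ i j → sym (above M₂-row i (suc j))))) ⟩
    b * det R (suc n) (leading M) + sgn R (suc n) * (a * det R (suc n) (minorLastFirst M)) ∎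
    where
    last : Fin (suc (suc n))
    last = fromℕ (suc n)
    M₁-row M₂-row : (Fin (suc (suc n)) → Carrier) → Fin (suc (suc n)) → Carrier
    M₁-row row j = row j - firstOnly a j
    M₂-row _ = firstOnly a
    M₁ M₂ : Matrix R (suc (suc n))
    M₁ = updateAt M last M₁-row
    M₂ = updateAt M last M₂-row
    above : ∀ f i j → M (inject₁ i) j ≈ updateAt M last f (inject₁ i) j
    above f i j =
      reflexive (≡.sym (≡.cong-app (updateAt-minimal (inject₁ i) last M (fromℕ≢inject₁ ∘ ≡.sym)) j))
    lastRow : ∀ f j → updateAt M last f last j ≈ f (M last) j
    lastRow f j = reflexive (≡.cong-app (updateAt-updates last M) j)
    split : ∀ j → M last j ≈ M₁ last j + M₂ last j
    split j = trans (sym (//-rightDividesˡ (firstOnly a j) (M last j)))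
                    (sym (+-cong (lastRow M₁-row j) (lastRow M₂-row j)))
    M₁-lastRow≈0 : ∀ j → M₁ last (inject₁ j) ≈ 0#
    M₁-lastRow≈0 zero    = trans (lastRow M₁-row zero) (x≈y⇒x∙y⁻¹≈ε first≈a)
    M₁-lastRow≈0 (suc j) = trans (lastRow M₁-row (suc (inject₁ j))) (x≈y⇒x∙y⁻¹≈ε (middle≈0 j))
    M₁-corner≈b : M₁ last last ≈ b
    M₁-corner≈b = trans (lastRow M₁-row last) (trans (x-0≈x _) last≈b)

module CharacteristicMatrix {c ℓ} (R : CommutativeRing c ℓ) (x : CommutativeRing.Carrier R) where
  open CommutativeRing R hiding (zero)
  open import Algebra.Properties.Ring ring using (-‿involutive; x[y-z]≈xy-xz)
  open RingLemmas R
  open Determinant R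
  open import Relation.Binary.Reasoning.Setoid setoid

  ι : Bool → Carrier
  ι b = if b then 1# else 0#

  -- 0-based entries of A⁽ⁿ⁾ − xI (r + suc s ≡ n is the paper's i + j = n + 1). The blocks
  -- below have any size m; upperLeft n n is definitionally the matrix behind P R n x.
  entry : ℕ → ℕ → ℕ → Carrier
  entry n r s = ι ((s ≡ᵇ suc r) ∨ (r ℕ.+ suc s ≡ᵇ n)) - x * ι (r ≡ᵇ s)

  upperLeft : ℕ → (m : ℕ) → Matrix R m
  upperLeft n m i j = entry n (toℕ i) (toℕ j)

  upperLeftShifted : ℕ → (m : ℕ) → Matrix R m
  upperLeftShifted n m i j = entry n (toℕ i) (suc (toℕ j))

  minus-x*0 : ∀ a → a - x * 0# ≈ a
  minus-x*0 a = trans (+-congˡ (-‿cong (zeroʳ x))) (x-0≈x a)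

  entry-shift : ∀ n r s → entry (suc (suc n)) (suc r) (suc s) ≡ entry n r s
  entry-shift n r s =
    ≡.cong (λ m → ι ((s ≡ᵇ suc r) ∨ (m ≡ᵇ suc n)) - x * ι (r ≡ᵇ s)) (+-suc r (suc s))

  entry-zero : ∀ n r s → s ≢ suc r → r ℕ.+ suc s ≢ n → r ≢ s → entry n r s ≈ 0#
  entry-zero n r s s≢r+1 off-anti r≢s = begin
    entry n r s ≡⟨ ≡.cong₂ (λ a d → ι a - x * ι d)
                     (≡.cong₂ _∨_ (dec-false (s ≟ suc r) s≢r+1) (dec-false (_ ≟ n) off-anti))
                     (dec-false (r ≟ s) r≢s) ⟩
    0# - x * 0# ≈⟨ minus-x*0 0# ⟩
    0#          ∎

  entry-super : ∀ n r → entry n r (suc r) ≈ 1#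
  entry-super n r = begin
    entry n r (suc r) ≡⟨ ≡.cong₂ (λ a d → ι (a ∨ (r ℕ.+ suc (suc r) ≡ᵇ n)) - x * ι d)
                           (dec-true (r ≟ r) ≡.refl) (dec-false (r ≟ suc r) (λ ())) ⟩
    1# - x * 0#       ≈⟨ minus-x*0 1# ⟩
    1#                ∎

  entry-anti : ∀ n r s → r ℕ.+ suc s ≡ n → r ≢ s → entry n r s ≈ 1#
  entry-anti n r s anti r≢s = begin
    entry n r s ≡⟨ ≡.cong₂ (λ a d → ι a - x * ι d)
                     (≡.trans (≡.cong ((s ≡ᵇ suc r) ∨_) (dec-true (_ ≟ n) anti)) (∨-zeroʳ _))
                     (dec-false (r ≟ s) r≢s) ⟩
    1# - x * 0# ≈⟨ minus-x*0 1# ⟩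
    1#          ∎

  entry-diag : ∀ n r → r ℕ.+ suc r ≢ n → entry n r r ≈ - x
  entry-diag n r off-anti = begin
    entry n r r ≡⟨ ≡.cong₂ (λ a d → ι a - x * ι d)
                     (≡.cong₂ _∨_ (dec-false (r ≟ suc r) (λ ())) (dec-false (_ ≟ n) off-anti))
                     (dec-true (r ≟ r) ≡.refl) ⟩
    0# - x * 1# ≈⟨ trans (+-identityˡ _) (-‿cong (*-identityʳ x)) ⟩
    - x         ∎

  -- The minor of A⁽ⁿ⁺¹⁾ − xI without its last row and first column.
  Q : ℕ → Carrier
  Q n = det R n (upperLeftShifted (suc n) n)

  leading-upperLeft : ∀ n m i j → leading (upperLeft n (suc m)) i j ≡ upperLeft n m i j
  leading-upperLeft n m i j = ≡.cong₂ (entry n) (toℕ-inject₁ i) (toℕ-inject₁ j)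

  leading-upperLeftShifted : ∀ n m i j → leading (upperLeftShifted n (suc m)) i j ≡ upperLeftShifted n m i j
  leading-upperLeftShifted n m i j = ≡.cong₂ (λ r s → entry n r (suc s)) (toℕ-inject₁ i) (toℕ-inject₁ j)

  minorLastFirst-upperLeft : ∀ n m i j →
    minorLastFirst (upperLeft n (suc (suc m))) i j ≡ upperLeftShifted n (suc m) i j
  minorLastFirst-upperLeft n m i j = ≡.cong (λ r → entry n r (suc (toℕ j))) (toℕ-inject₁ i)

  upperLeft-lastRow : ∀ n m j → upperLeft n (suc m) (fromℕ m) j ≡ entry n m (toℕ j)
  upperLeft-lastRow n m j = ≡.cong (λ r → entry n r (toℕ j)) (toℕ-fromℕ m)

  det-upperLeft≈-x*P : ∀ k → det R (suc (suc k)) (upperLeft (3 ℕ.+ k) (suc (suc k))) ≈ - x * P R (suc k) x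
  det-upperLeft≈-x*P k = begin
    det R (suc (suc k)) (upperLeft N (suc (suc k)))
      ≈⟨ det-firstColumn-corner k (upperLeft N (suc (suc k))) firstColumn≈0 ⟩
    entry N 0 0 * det R (suc k) (λ i j → entry N (suc (toℕ i)) (suc (toℕ j)))
      ≈⟨ *-cong (entry-diag N 0 (λ ())) (det-cong (suc k) λ i j → reflexive (entry-shift (suc k) (toℕ i) (toℕ j))) ⟩
    - x * P R (suc k) x ∎
    where
    N : ℕ
    N = 3 ℕ.+ k
    firstColumn≈0 : ∀ i → entry N (suc (toℕ i)) 0 ≈ 0#
    firstColumn≈0 i = entry-zero N (suc (toℕ i)) 0 (λ ())
      (λ e → <⇒≢ (toℕ<n i) (suc-injective (≡.trans (ℕₚ.+-comm 1 (toℕ i)) (suc-injective e))))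
      (λ ())

  P-step : ∀ k → P R (suc (suc (suc k))) x ≈ x * x * P R (suc k) x + sgn R (suc (suc k)) * Q (suc (suc k))
  P-step k = begin
    det R N (upperLeft N N)
      ≈⟨ det-lastRow-firstLast (suc k) (upperLeft N N) 1# (- x) first≈1 last≈-x middle≈0 ⟩
    - x * det R m (leading (upperLeft N N)) + sgn R m * (1# * det R m (minorLastFirst (upperLeft N N)))
      ≈⟨ +-cong (*-congˡ (trans (det-cong m λ i j → reflexive (leading-upperLeft N m i j))
                                (det-upperLeft≈-x*P k)))
                (*-congˡ (trans (*-identityˡ _)
                                (det-cong m λ i j → reflexive (minorLastFirst-upperLeft N (suc k) i j)))) ⟩
    - x * (- x * P R (suc k) x) + sgn R m * Q m
      ≈⟨ +-congʳ (trans (sym (*-assoc (- x) (- x) _)) (*-congʳ (-x*-y≈x*y x x))) ⟩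
    x * x * P R (suc k) x + sgn R m * Q m ∎
    where
    m N : ℕ
    m = suc (suc k)
    N = suc m
    first≈1 : upperLeft N N (fromℕ m) zero ≈ 1#
    first≈1 = trans (reflexive (upperLeft-lastRow N m zero)) (entry-anti N m 0 (ℕₚ.+-comm m 1) (λ ()))
    last≈-x : upperLeft N N (fromℕ m) (fromℕ m) ≈ - x
    last≈-x = trans (reflexive (≡.trans (upperLeft-lastRow N m (fromℕ m)) (≡.cong (entry N m) (toℕ-fromℕ m))))
                    (entry-diag N m (≢-sym (m≢1+n+m N {suc k})))
    middle≈0 : ∀ j → upperLeft N N (fromℕ m) (suc (inject₁ j)) ≈ 0#
    middle≈0 j = trans (reflexive (upperLeft-lastRow N m (suc (inject₁ j))))
      (entry-zero N m (suc t) (<⇒≢ (s<s (m<n⇒m<1+n t<)))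
        (λ e → m+1+n≢m m (suc-injective (≡.trans (≡.sym (+-suc m (suc t))) e)))
        (>⇒≢ (s<s t<)))
      where
      t : ℕ
      t = toℕ (inject₁ j)
      t< : t < suc k
      t< = inject₁ℕ< j

  det-upperLeftShifted≈Q : ∀ n → det R (suc n) (upperLeftShifted (suc n) (suc n)) ≈ Q n
  det-upperLeftShifted≈Q n = begin
    det R (suc n) (upperLeftShifted (suc n) (suc n))
      ≈⟨ det-lastColumn-corner n (upperLeftShifted (suc n) (suc n)) 1# lastColumn≈0
           (entry-super (suc n) (toℕ (fromℕ n))) ⟩
    1# * det R n (leading (upperLeftShifted (suc n) (suc n)))
      ≈⟨ trans (*-identityˡ _) (det-cong n λ i j → reflexive (leading-upperLeftShifted (suc n) n i j)) ⟩
    Q n ∎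
    where
    lastColumn≈0 : ∀ i → upperLeftShifted (suc n) (suc n) (inject₁ i) (fromℕ n) ≈ 0#
    lastColumn≈0 i = trans (reflexive (≡.cong (λ s → entry (suc n) t (suc s)) (toℕ-fromℕ n)))
      (entry-zero (suc n) t (suc n) (>⇒≢ (s<s t<)) (m+1+n≢n t) (<⇒≢ (m<n⇒m<1+n t<)))
      where
      t : ℕ
      t = toℕ (inject₁ i)
      t< : t < n
      t< = inject₁ℕ< i

  Q-step : ∀ n → Q (suc (suc n)) ≈ Q n + sgn R (suc n) * P R (suc n) x
  Q-step n = begin
    det R (suc (suc n)) Y
      ≈⟨ det-firstRow-firstLast n Y middle≈0 ⟩
    Y zero zero * det R (suc n) (minor R Y zero)
      + sgn R (suc n) * (Y zero (fromℕ (suc n)) * det R (suc n) (minor R Y (fromℕ (suc n))))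
      ≈⟨ +-cong (*-cong (entry-super N 0)
                        (trans (det-cong (suc n) λ i j → reflexive (entry-shift (suc n) (toℕ i) (suc (toℕ j))))
                               (det-upperLeftShifted≈Q n)))
                (*-congˡ (*-cong last≈1 (det-cong (suc n) λ i j → reflexive (lastMinor i j)))) ⟩
    1# * Q n + sgn R (suc n) * (1# * P R (suc n) x)
      ≈⟨ +-cong (*-identityˡ _) (*-congˡ (*-identityˡ _)) ⟩
    Q n + sgn R (suc n) * P R (suc n) x ∎
    where
    N : ℕ
    N = suc (suc (suc n))
    Y : Matrix R (suc (suc n))
    Y = upperLeftShifted N (suc (suc n))
    middle≈0 : ∀ i → Y zero (suc (inject₁ i)) ≈ 0#
    middle≈0 i = entry-zero N 0 (suc (suc (toℕ (inject₁ i)))) (λ ()) (<⇒≢ (s<s (s<s (s<s (inject₁ℕ< i))))) (λ ())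
    last≈1 : Y zero (fromℕ (suc n)) ≈ 1#
    last≈1 = trans (reflexive (≡.cong (λ s → entry N 0 (suc s)) (toℕ-fromℕ (suc n))))
                   (entry-anti N 0 (suc (suc n)) ≡.refl (λ ()))
    lastMinor : ∀ i j → minor R Y (fromℕ (suc n)) i j ≡ upperLeft (suc n) (suc n) i j
    lastMinor i j = ≡.trans (entry-shift (suc n) (toℕ i) _)
      (≡.cong (λ s → entry (suc n) (toℕ i) s) (≡.trans (≡.cong toℕ (punchIn-fromℕ j)) (toℕ-inject₁ j)))

  P-recurrence : ∀ t → P R (6 ℕ.+ t) x ≈ x * x * (P R (4 ℕ.+ t) x - P R (2 ℕ.+ t) x)
  P-recurrence t = begin
    P R (6 ℕ.+ t) x
      ≈⟨ P-step (3 ℕ.+ t) ⟩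
    x * x * P₄ + sgn R (5 ℕ.+ t) * Q (5 ℕ.+ t)
      ≈⟨ +-congˡ (*-congˡ (Q-step (3 ℕ.+ t))) ⟩
    x * x * P₄ + sgn R (5 ℕ.+ t) * (Q (3 ℕ.+ t) + sgn R (4 ℕ.+ t) * P₄)
      ≈⟨ +-congˡ (trans (distribˡ _ _ _) (+-cong (*-congʳ (-‿involutive σ)) (sgn-suc-cancel (4 ℕ.+ t) P₄))) ⟩
    x * x * P₄ + (σ * Q (3 ℕ.+ t) - P₄)
      ≈⟨ +-congˡ (+-congˡ (-‿cong (P-step (1 ℕ.+ t)))) ⟩
    x * x * P₄ + (σ * Q (3 ℕ.+ t) - (x * x * P₂ + σ * Q (3 ℕ.+ t)))
      ≈⟨ +-congˡ (y-[x+y]≈-x (x * x * P₂) (σ * Q (3 ℕ.+ t))) ⟩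
    x * x * P₄ - x * x * P₂
      ≈⟨ x[y-z]≈xy-xz (x * x) P₄ P₂ ⟨
    x * x * (P₄ - P₂) ∎
    where
    P₄ P₂ σ : Carrier
    P₄ = P R (4 ℕ.+ t) x
    P₂ = P R (2 ℕ.+ t) x
    σ = sgn R (3 ℕ.+ t)


lemma2p1 : ∀ {c ℓ} (R : CommutativeRing c ℓ) (n : ℕ) → 6 ≤ n → (x : CommutativeRing.Carrier R) →
    CommutativeRing._≈_ R (P R n x)
      (CommutativeRing._*_ R (CommutativeRing._*_ R x x)
        (CommutativeRing._-_ R (P R (n ∸ 2) x) (P R (n ∸ 4) x)))
lemma2p1 R (suc (suc (suc (suc (suc (suc t)))))) (s≤s (s≤s (s≤s (s≤s (s≤s (s≤s z≤n)))))) x =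
  CharacteristicMatrix.P-recurrence R x t
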